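{- If $A$ is a formula derivable in the deep inference system $\mathsf{MLL}_{DI}$, then $$\big(n^-_{\otimes}(A)+n^+_{\wp}(A)\big)-\big(n^+_{\otimes}(A)+n^-_{\wp}(A)\big)=1.$$
   Context: $\wp$ denotes par and $\otimes$ tensor. Formulae are built from atoms $\alpha_i$ and negated atoms $\overline{\alpha_i}$ using $\otimes$ and $\wp$; negation of a compound formula is defined by $\overline{A\otimes B}=\overline{A}\wp\overline{B}$, $\overline{A\wp B}=\overline{A}\otimes\overline{B}$, $\overline{\overline{\alpha}}=\alpha$. Formulae are not identified up to associativity or commutativity. A context $S\{\ \}$ is a formula with one hole; $S\{B\}$ denotes the result of filling the hole with $B$. The system $\mathsf{MLL}_{DI}$ has the axiom $\mathsf{i}{\downarrow}$ with conclusion $\overline{A}\wp A$ (no premise), and the following rules, each rewriting a premise $S\{P\}$ into a conclusion $S\{Q\}$ for an arbitrary context $S$: $\mathsf{i}{\downarrow}$: $S\{B\}\to S\{B\otimes(\overline{A}\wp A)\}$; $\mathsf{i}{\uparrow}$: $S\{(A\otimes\overline{A})\wp B\}\to S\{B\}$; $\sigma{\uparrow}$: $S\{A\wp B\}\to S\{B\wp A\}$; $\sigma{\downarrow}$: $S\{A\otimes B\}\to S\{B\otimes A\}$; $\alpha{\uparrow}$: $S\{A\wp(B\wp C)\}\to S\{(A\wp B)\wp C\}$; $\alpha{\downarrow}$: $S\{(A\otimes B)\otimes C\}\to S\{A\otimes(B\otimes C)\}$; switch $\mathsf{s}$: $S\{A\otimes(B\wp C)\}\to S\{(A\otimes B)\wp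 C\}$. A formula is derivable if it is the last formula of a finite sequence starting with an axiom instance in which each subsequent formula is obtained from the previous one by a rule. In the counting, a connective occurrence occurs positively if the number of negation overlines above it is even, negatively otherwise (formulas may be read as expressions with overlines, equivalent up to the DeMorgan laws); $n^{\pm}_{\otimes}(A)$, $n^{\pm}_{\wp}(A)$ count positive/negative occurrences of $\otimes$, $\wp$ in $A$. -}

module Defs where

open import Data.Nat using (ℕ; zero; suc; _+_)
open import Data.Integer using (ℤ; _-_; +_)
open import Data.List using (List; []; _∷_)

-- Formulae of MLL in negation normal form: atoms, negated atoms, ⊗, ⅋.
-- Formulae are NOT identified up to associativity or commutativity.
data Formula : Set where
  atom    : ℕ → Formula
  natom   : ℕ → Formula
  _⊗_     : Formula → Formula → Formula
  _⅋_     : Formula → Formula → Formula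

infixr 6 _⊗_
infixr 5 _⅋_

neg : Formula → Formula
neg (atom a)  = natom a
neg (natom a) = atom a
neg (A ⊗ B)   = neg A ⅋ neg B
neg (A ⅋ B)   = neg A ⊗ neg B

data Context : Set where
  hole : Context
  _⊗ₗ_ : Context → Formula → Context
  _⊗ᵣ_ : Formula → Context → Context
  _⅋ₗ_ : Context → Formula → Context
  _⅋ᵣ_ : Formula → Context → Context

plug : Context → Formula → Formula
plug hole      B = B
plug (S ⊗ₗ C) B = plug S B ⊗ C
plug (C ⊗ᵣ S) B = C ⊗ plug S B
plug (S ⅋ₗ C) B = plug S B ⅋ C
plug (C ⅋ᵣ S) B = C ⅋ plug S B

-- the rules of MLL_DI, applied at the root (premise P, conclusion Q)
data Rule : Formula → Formula → Set where
  i↓  : ∀ A B → Rule B (B ⊗ (neg A ⅋ A))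
  i↑  : ∀ A B → Rule ((A ⊗ neg A) ⅋ B) B
  σ↑  : ∀ A B → Rule (A ⅋ B) (B ⅋ A)
  σ↓  : ∀ A B → Rule (A ⊗ B) (B ⊗ A)
  α↑  : ∀ A B C → Rule (A ⅋ (B ⅋ C)) ((A ⅋ B) ⅋ C)
  α↓  : ∀ A B C → Rule ((A ⊗ B) ⊗ C) (A ⊗ (B ⊗ C))
  s   : ∀ A B C → Rule (A ⊗ (B ⅋ C)) ((A ⊗ B) ⅋ C)

data Step : Formula → Formula → Set where
  step : ∀ S {P Q} → Rule P Q → Step (plug S P) (plug S Q)

data Derivable : Formula → Set where
  axiom : ∀ A → Derivable (neg A ⅋ A)
  infer : ∀ {P Q} → Derivable P → Step P Q → Derivable Q

-- Polarity-aware counts.  A formula is read as an expression; since our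
-- formulae are in negation normal form, every ⊗/⅋ occurrence lies under
-- zero overlines, hence occurs positively.
data Polarity : Set where
  pos negv : Polarity

n⊗ : Polarity → Formula → ℕ
n⊗ p (atom _)  = 0
n⊗ p (natom _) = 0
n⊗ pos  (A ⊗ B) = suc (n⊗ pos A + n⊗ pos B)
n⊗ negv (A ⊗ B) = n⊗ negv A + n⊗ negv B
n⊗ p (A ⅋ B)   = n⊗ p A + n⊗ p B

n⅋ : Polarity → Formula → ℕ
n⅋ p (atom _)  = 0
n⅋ p (natom _) = 0
n⅋ p (A ⊗ B)   = n⅋ p A + n⅋ p B
n⅋ pos  (A ⅋ B) = suc (n⅋ pos A + n⅋ pos B)
n⅋ negv (A ⅋ B) = n⅋ negv A + n⅋ negv B

-- Weigh a formula by counting each ⅋ as +1 and each ⊗ as −1. Negation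
-- flips the sign of the weight, so every axiom ¬A ⅋ A weighs 1; every rule
-- of MLL_DI has premise and conclusion of equal weight, and the weight is
-- compositional, so it is invariant under rewriting in any context.
module Submission where

open import Defs
open import Data.Nat using (_+_)
open import Data.Integer using (ℤ; +_; -_; _-_; 0ℤ; 1ℤ) renaming (_+_ to _+ℤ_)
open import Data.Integer.Tactic.RingSolver using (solve-∀)
open import Relation.Binary.PropositionalEquality using (_≡_; refl; cong; trans; sym)

weight : Formula → ℤ
weight (atom _)  = 0ℤ
weight (natom _) = 0ℤ
weight (A ⊗ B)   = weight A +ℤ weight B - 1ℤ
weight (A ⅋ B)   = weight A +ℤ weight B +ℤ 1ℤ

weight-neg : ∀ A → weight (neg A) ≡ - weight A
weight-neg (atom _)  = refl
weight-neg (natom _) = refl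
weight-neg (A ⊗ B) rewrite weight-neg A | weight-neg B = lemma (weight A) (weight B)
  where
  lemma : ∀ a b → - a +ℤ - b +ℤ 1ℤ ≡ - (a +ℤ b - 1ℤ)
  lemma = solve-∀
weight-neg (A ⅋ B) rewrite weight-neg A | weight-neg B = lemma (weight A) (weight B)
  where
  lemma : ∀ a b → - a +ℤ - b - 1ℤ ≡ - (a +ℤ b +ℤ 1ℤ)
  lemma = solve-∀

weight-axiom : ∀ A → weight (neg A ⅋ A) ≡ 1ℤ
weight-axiom A rewrite weight-neg A = lemma (weight A)
  where
  lemma : ∀ a → - a +ℤ a +ℤ 1ℤ ≡ 1ℤ
  lemma = solve-∀

weight-rule : ∀ {P Q} → Rule P Q → weight P ≡ weight Q
weight-rule (i↓ A B) rewrite weight-neg A = lemma (weight A) (weight B)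
  where
  lemma : ∀ a b → b ≡ b +ℤ (- a +ℤ a +ℤ 1ℤ) - 1ℤ
  lemma = solve-∀
weight-rule (i↑ A B) rewrite weight-neg A = lemma (weight A) (weight B)
  where
  lemma : ∀ a b → a +ℤ - a - 1ℤ +ℤ b +ℤ 1ℤ ≡ b
  lemma = solve-∀
weight-rule (σ↑ A B) = lemma (weight A) (weight B)
  where
  lemma : ∀ a b → a +ℤ b +ℤ 1ℤ ≡ b +ℤ a +ℤ 1ℤ
  lemma = solve-∀
weight-rule (σ↓ A B) = lemma (weight A) (weight B)
  where
  lemma : ∀ a b → a +ℤ b - 1ℤ ≡ b +ℤ a - 1ℤ
  lemma = solve-∀
weight-rule (α↑ A B C) = lemma (weight A) (weight B) (weight C)
  where
  lemma : ∀ a b c → a +ℤ (b +ℤ c +ℤ 1ℤ) +ℤ 1ℤ ≡ a +ℤ b +ℤ 1ℤ +ℤ c +ℤ 1ℤ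
  lemma = solve-∀
weight-rule (α↓ A B C) = lemma (weight A) (weight B) (weight C)
  where
  lemma : ∀ a b c → a +ℤ b - 1ℤ +ℤ c - 1ℤ ≡ a +ℤ (b +ℤ c - 1ℤ) - 1ℤ
  lemma = solve-∀
weight-rule (s A B C) = lemma (weight A) (weight B) (weight C)
  where
  lemma : ∀ a b c → a +ℤ (b +ℤ c +ℤ 1ℤ) - 1ℤ ≡ a +ℤ b - 1ℤ +ℤ c +ℤ 1ℤ
  lemma = solve-∀

weight-plug : ∀ S {P Q} → weight P ≡ weight Q → weight (plug S P) ≡ weight (plug S Q)
weight-plug hole     eq = eq
weight-plug (S ⊗ₗ C) eq = cong (λ w → w +ℤ weight C - 1ℤ) (weight-plug S eq)
weight-plug (C ⊗ᵣ S) eq = cong (λ w → weight C +ℤ w - 1ℤ) (weight-plug S eq)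
weight-plug (S ⅋ₗ C) eq = cong (λ w → w +ℤ weight C +ℤ 1ℤ) (weight-plug S eq)
weight-plug (C ⅋ᵣ S) eq = cong (λ w → weight C +ℤ w +ℤ 1ℤ) (weight-plug S eq)

weight-step : ∀ {P Q} → Step P Q → weight P ≡ weight Q
weight-step (step S r) = weight-plug S (weight-rule r)

weight-derivable : ∀ {A} → Derivable A → weight A ≡ 1ℤ
weight-derivable (axiom A)   = weight-axiom A
weight-derivable (infer d r) = trans (sym (weight-step r)) (weight-derivable d)

count-difference : Formula → ℤ
count-difference A = + (n⊗ negv A + n⅋ pos A) - + (n⊗ pos A + n⅋ negv A)

-- The ℤ lemmas below apply to the ℕ counts since + (m + n) and + m +ℤ + n
-- are definitionally equal.
weight≡count-difference : ∀ A → weight A ≡ count-difference A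
weight≡count-difference (atom _)  = refl
weight≡count-difference (natom _) = refl
weight≡count-difference (A ⊗ B) rewrite weight≡count-difference A | weight≡count-difference B =
  lemma (+ n⊗ negv A) (+ n⊗ negv B) (+ n⅋ pos A) (+ n⅋ pos B)
        (+ n⊗ pos A) (+ n⊗ pos B) (+ n⅋ negv A) (+ n⅋ negv B)
  where
  lemma : ∀ m₁ m₂ p₁ p₂ t₁ t₂ q₁ q₂ →
    (m₁ +ℤ p₁ - (t₁ +ℤ q₁)) +ℤ (m₂ +ℤ p₂ - (t₂ +ℤ q₂)) - 1ℤ
      ≡ (m₁ +ℤ m₂ +ℤ (p₁ +ℤ p₂)) - (1ℤ +ℤ (t₁ +ℤ t₂) +ℤ (q₁ +ℤ q₂))
  lemma = solve-∀
weight≡count-difference (A ⅋ B) rewrite weight≡count-difference A | weight≡count-difference B =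
  lemma (+ n⊗ negv A) (+ n⊗ negv B) (+ n⅋ pos A) (+ n⅋ pos B)
        (+ n⊗ pos A) (+ n⊗ pos B) (+ n⅋ negv A) (+ n⅋ negv B)
  where
  lemma : ∀ m₁ m₂ p₁ p₂ t₁ t₂ q₁ q₂ →
    (m₁ +ℤ p₁ - (t₁ +ℤ q₁)) +ℤ (m₂ +ℤ p₂ - (t₂ +ℤ q₂)) +ℤ 1ℤ
      ≡ (m₁ +ℤ m₂ +ℤ (1ℤ +ℤ (p₁ +ℤ p₂))) - (t₁ +ℤ t₂ +ℤ (q₁ +ℤ q₂))
  lemma = solve-∀

theorem3p4 : (A : Formula) → Derivable A →
    (+ (n⊗ negv A + n⅋ pos A)) - (+ (n⊗ pos A + n⅋ negv A)) ≡ + 1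
theorem3p4 A d = trans (sym (weight≡count-difference A)) (weight-derivable d)
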